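{- Let $i:[u]\to[r]$ and $s:[u]\to\{ -1,1\}$ be random functions, writing $i_x=i(x)$, $s_x=s(x)$. Assume: (Sign Cancellation with $k=4$) for any distinct keys $x_0,\ldots,x_{j-1}\in[u]$ with $j\le 4$ and any real random variable $A$ that is a function of $i_{x_0},\ldots,i_{x_{j-1}}$ and $s_{x_1},\ldots,s_{x_{j-1}}$ but not of $s_{x_0}$, we have $\mathbb E[s_{x_0}A]=0$; and (Low collision) there is $\varepsilon\ge 0$ such that $\Pr[i_x=i_y]\le(1+\varepsilon)/r$ for all distinct $x,y\in[u]$. Let $f\in\mathbb Z^u$ be fixed, $F_m=\sum_{x\in[u]}f_x^m$, $C_t=\sum_{x\in[u]}s_xf_x[i_x=t]$ for $t\in[r]$, and $X=\sum_{t\in[r]}C_t^2$. Then $$\mathbb E[X]=F_2,\qquad \operatorname{Var}[X]\le 2(1+\varepsilon)(F_2^2-F_4)/r\le 2(1+\varepsilon)F_2^2/r.$$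
   Context: $[m]=\{0,\ldots,m-1\}$; $[P]$ is $1$ if $P$ holds and $0$ otherwise.
   Formalization: The joint distribution of the random functions i and s has rational probabilities, and the parameter ε is rational. -}

module Defs where

open import Data.Nat as ℕ using (ℕ; zero; suc)
open import Data.Fin as Fin using (Fin; zero; suc)
open import Data.Integer as ℤ using (ℤ)
open import Data.Rational using (ℚ; 0ℚ; 1ℚ; _+_; _*_; _-_; _≤_; _/_)
open import Data.Sign using (Sign)
open import Data.List using (List; []; _∷_)
open import Data.List.Relation.Unary.All using (All)
open import Data.Product using (_×_; _,_; proj₁; proj₂)
open import Relation.Binary.PropositionalEquality using (_≡_; _≢_)
open import Relation.Nullary.Decidable using (Dec; yes; no)
open import Function using (_∘_)
open import Function.Definitions using (Injective)

ℤ→ℚ : ℤ → ℚ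
ℤ→ℚ z = z / 1

sumFin : (n : ℕ) → (Fin n → ℚ) → ℚ
sumFin zero    g = 0ℚ
sumFin (suc n) g = g zero + sumFin n (g ∘ suc)

sumList : {A : Set} → List A → (A → ℚ) → ℚ
sumList []       g = 0ℚ
sumList (a ∷ as) g = g a + sumList as g

[_] : {P : Set} → Dec P → ℚ
[ yes _ ] = 1ℚ
[ no  _ ] = 0ℚ

signℚ : Sign → ℚ
signℚ Sign.- = ℤ→ℚ (ℤ.-[1+ 0 ])
signℚ Sign.+ = 1ℚ

-- an outcome of the pair of random functions  i : [u] → [r],  s : [u] → {-1,1}
Outcome : ℕ → ℕ → Set
Outcome u r = (Fin u → Fin r) × (Fin u → Sign)

record Distribution (A : Set) : Set where
  field
    support : List (ℚ × A)
    nonneg  : All (λ p → 0ℚ ≤ proj₁ p) support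
    total   : sumList support proj₁ ≡ 1ℚ
open Distribution public

𝔼 : {A : Set} → Distribution A → (A → ℚ) → ℚ
𝔼 D Z = sumList (support D) (λ p → proj₁ p * Z (proj₂ p))

Var : {A : Set} → Distribution A → (A → ℚ) → ℚ
Var D Z = 𝔼 D (λ a → Z a * Z a) - 𝔼 D Z * 𝔼 D Z

-- Sign cancellation with parameter k: for distinct keys x₀,…,x_{j-1} (1 ≤ j ≤ k; j = suc m)
-- and any A depending on i_{x₀},…,i_{x_{j-1}} and s_{x₁},…,s_{x_{j-1}}:  E[s_{x₀} A] = 0
SignCancellation : {u r : ℕ} → ℕ → Distribution (Outcome u r) → Set
SignCancellation {u} {r} k D =
  (m : ℕ) → suc m ℕ.≤ k →
  (x : Fin (suc m) → Fin u) → Injective _≡_ _≡_ x →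
  (A : (Fin (suc m) → Fin r) → (Fin m → Sign) → ℚ) →
  𝔼 D (λ ω → signℚ (proj₂ ω (x zero)) * A (proj₁ ω ∘ x) (proj₂ ω ∘ x ∘ suc)) ≡ 0ℚ

LowCollision : {u r : ℕ} → .{{_ : ℕ.NonZero r}} → ℚ → Distribution (Outcome u r) → Set
LowCollision {u} {r} ε D =
  (x y : Fin u) → x ≢ y →
  𝔼 D (λ ω → [ proj₁ ω x Fin.≟ proj₁ ω y ]) ≤ (1ℚ + ε) * (ℤ.+ 1 / r)

F : {u : ℕ} → ℕ → (Fin u → ℤ) → ℚ
F {u} m f = sumFin u (λ x → ℤ→ℚ (f x ℤ.^ m))

C : {u r : ℕ} → (Fin u → ℤ) → Fin r → Outcome u r → ℚ
C {u} f t ω = sumFin u (λ x → signℚ (proj₂ ω x) * ℤ→ℚ (f x) * [ proj₁ ω x Fin.≟ t ])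

X : {u r : ℕ} → (Fin u → ℤ) → Outcome u r → ℚ
X {u} {r} f ω = sumFin r (λ t → C f t ω * C f t ω)

-- Expanding the squares, X = Σ_{x,y} T_xy with T_xy = s_x s_y f_x f_y [i_x = i_y]: its diagonal is
-- F₂, and we call the remaining terms the cross terms Y. Sign cancellation on two keys gives E[Y] = 0, hence
-- E[X] = F₂ and Var[X] = E[Y²]. Writing E[Y²] as a sum of E[T_xy T_zw] with x ≠ y and z ≠ w, every
-- term in which some key occurs only once vanishes by sign cancellation on at most four keys. Only
-- {z, w} = {x, y} survives, contributing 2 f_x² f_y² Pr[i_x = i_y] ≤ 2 f_x² f_y² (1 + ε)/r, and the
-- sum of f_x² f_y² over x ≠ y is F₂² − F₄.

{-# OPTIONS --safe #-}
module Submission where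

open import Defs
open import Data.Nat using (ℕ; NonZero)
open import Data.Fin using (Fin)
open import Data.Integer using (ℤ; +_)
open import Data.Rational using (ℚ; 0ℚ; 1ℚ; _+_; _*_; _-_; _≤_; _/_)
open import Data.Product using (_×_)
open import Relation.Binary.PropositionalEquality using (_≡_)

open import Data.Nat as ℕ using (zero; suc)
import Data.Nat.Properties as ℕ
open import Data.Fin using (zero; suc)
open import Data.Fin.Properties using (_≟_; suc-injective)
import Data.Integer as ℤ
import Data.Integer.Properties as ℤ
open import Data.Rational using (NonNegative; nonNegative; nonPositive)
open import Data.Rational.Properties hiding (_≟_)
import Data.Rational.Unnormalised as ℚᵘ
import Data.Rational.Unnormalised.Properties as ℚᵘ
open import Data.Rational.Solver using (module +-*-Solver)
open import Data.Product using (_,_; proj₁; proj₂)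
open import Data.Sum using (_⊎_; inj₁; inj₂)
open import Data.List as List using (List)
open import Data.Sign using (Sign)
open import Data.Vec.Functional using ([]; _∷_)
open import Relation.Binary.PropositionalEquality using (_≢_; refl; sym; trans; cong; cong₂; module ≡-Reasoning)
open import Relation.Nullary using (Dec; yes; no; ¬_; ¬?; contradiction)
open import Function using (_∘_)
open import Function.Definitions using (Injective)
open import Algebra.Bundles using (Ring; CommutativeMonoid)
open import Algebra.Properties.Semiring.Sum (Ring.semiring +-*-ring)
  using (sum; sum-syntax; sum-cong-≗; sum-replicate-zero; ∑-distrib-+; ∑-comm; *-distribˡ-sum; *-distribʳ-sum)

open import Algebra.Properties.CommutativeSemigroup (CommutativeMonoid.commutativeSemigroup *-1-commutativeMonoid)
  using (x∙yz≈y∙xz)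
open import Algebra.Properties.CommutativeSemigroup (CommutativeMonoid.commutativeSemigroup +-0-commutativeMonoid)
  using () renaming (interchange to +-interchange)

open +-*-Solver

[]≡1 : {P : Set} (d : Dec P) → P → [ d ] ≡ 1ℚ
[]≡1 (yes _) _ = refl
[]≡1 (no ¬p) p = contradiction p ¬p

[]≡0 : {P : Set} (d : Dec P) → ¬ P → [ d ] ≡ 0ℚ
[]≡0 (yes p) ¬p = contradiction p ¬p
[]≡0 (no _) _ = refl

[]-idem : {P : Set} (d : Dec P) → [ d ] * [ d ] ≡ [ d ]
[]-idem (yes _) = refl
[]-idem (no _) = refl

[]+[¬]≡1 : {P : Set} (d : Dec P) → [ d ] + [ ¬? d ] ≡ 1ℚ
[]+[¬]≡1 (yes _) = refl
[]+[¬]≡1 (no _) = refl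

[≟]-sym : ∀ {n} (a b : Fin n) → [ a ≟ b ] ≡ [ b ≟ a ]
[≟]-sym a b with a ≟ b
... | yes refl = sym ([]≡1 (a ≟ a) refl)
... | no a≢b = sym ([]≡0 (b ≟ a) (a≢b ∘ sym))

[_≠_] : ∀ {n} → Fin n → Fin n → ℚ
[ a ≠ b ] = [ ¬? (a ≟ b) ]

[≠]*-cong : ∀ {n} (a b : Fin n) {p q : ℚ} → (a ≢ b → p ≡ q) → [ a ≠ b ] * p ≡ [ a ≠ b ] * q
[≠]*-cong a b {p} {q} p≡q with a ≟ b
... | yes _ = trans (*-zeroˡ p) (sym (*-zeroˡ q))
... | no a≢b = cong (1ℚ *_) (p≡q a≢b)

[≠]*-vanish : ∀ {n} (a b : Fin n) {p : ℚ} → (a ≢ b → p ≡ 0ℚ) → [ a ≠ b ] * p ≡ 0ℚ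
[≠]*-vanish a b p≡0 = trans ([≠]*-cong a b p≡0) (*-zeroʳ [ a ≠ b ])

[≠]*-distinct : ∀ {n} {a b : Fin n} {p : ℚ} → a ≢ b → [ a ≠ b ] * p ≡ p
[≠]*-distinct {a = a} {b} {p} a≢b = trans (cong (_* p) ([]≡1 (¬? (a ≟ b)) a≢b)) (*-identityˡ p)

signℚ²≡1 : ∀ s → signℚ s * signℚ s ≡ 1ℚ
signℚ²≡1 Sign.- = refl
signℚ²≡1 Sign.+ = refl

ℤ→ℚ-* : ∀ a b → ℤ→ℚ (a ℤ.* b) ≡ ℤ→ℚ a * ℤ→ℚ b
ℤ→ℚ-* a b = toℚᵘ-injective (ℚᵘ.≃-trans (toℚᵘ-fromℚᵘ (ℚᵘ.mkℚᵘ (a ℤ.* b) 0))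
  (ℚᵘ.≃-sym (ℚᵘ.≃-trans (toℚᵘ-homo-* (ℤ→ℚ a) (ℤ→ℚ b))
    (ℚᵘ.≃-trans (ℚᵘ.*-cong (toℚᵘ-fromℚᵘ (ℚᵘ.mkℚᵘ a 0)) (toℚᵘ-fromℚᵘ (ℚᵘ.mkℚᵘ b 0)))
                (ℚᵘ.*≡* refl)))))

ℤ→ℚ-^2 : ∀ a → ℤ→ℚ (a ℤ.^ 2) ≡ ℤ→ℚ a * ℤ→ℚ a
ℤ→ℚ-^2 a = trans (cong (λ b → ℤ→ℚ (a ℤ.* b)) (ℤ.*-identityʳ a)) (ℤ→ℚ-* a a)

ℤ→ℚ-^4 : ∀ a → ℤ→ℚ (a ℤ.^ 4) ≡ (ℤ→ℚ a * ℤ→ℚ a) * (ℤ→ℚ a * ℤ→ℚ a)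
ℤ→ℚ-^4 a = begin
  ℤ→ℚ (a ℤ.^ 4)                   ≡⟨ cong ℤ→ℚ (ℤ.^-distribˡ-+-* a 2 2) ⟩
  ℤ→ℚ (a ℤ.^ 2 ℤ.* a ℤ.^ 2)       ≡⟨ ℤ→ℚ-* (a ℤ.^ 2) (a ℤ.^ 2) ⟩
  ℤ→ℚ (a ℤ.^ 2) * ℤ→ℚ (a ℤ.^ 2)   ≡⟨ cong₂ _*_ (ℤ→ℚ-^2 a) (ℤ→ℚ-^2 a) ⟩
  (ℤ→ℚ a * ℤ→ℚ a) * (ℤ→ℚ a * ℤ→ℚ a) ∎
  where open ≡-Reasoning

0≤p*p : ∀ p → 0ℚ ≤ p * p
0≤p*p p = ≤-trans (≤-reflexive (sym (*-zeroˡ p))) (0*p≤p*p (≤-total 0ℚ p))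
  where
  0*p≤p*p : 0ℚ ≤ p ⊎ p ≤ 0ℚ → 0ℚ * p ≤ p * p
  0*p≤p*p (inj₁ 0≤p) = *-monoʳ-≤-nonNeg p {{nonNegative 0≤p}} 0≤p
  0*p≤p*p (inj₂ p≤0) = *-monoʳ-≤-nonPos p {{nonPositive p≤0}} p≤0

p-q≤p : ∀ p {q} → 0ℚ ≤ q → p - q ≤ p
p-q≤p p 0≤q = ≤-trans (+-monoʳ-≤ p (neg-antimono-≤ 0≤q)) (≤-reflexive (+-identityʳ p))

sumFin≡sum : ∀ n (g : Fin n → ℚ) → sumFin n g ≡ sum g
sumFin≡sum zero    g = refl
sumFin≡sum (suc n) g = cong (_+_ (g zero)) (sumFin≡sum n (g ∘ suc))

∑-zero : ∀ {n} {g : Fin n → ℚ} → (∀ i → g i ≡ 0ℚ) → sum g ≡ 0ℚ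
∑-zero {n} g≡0 = trans (sum-cong-≗ g≡0) (sum-replicate-zero n)

∑-support₁ : ∀ {n} {g : Fin n → ℚ} a → (∀ i → i ≢ a → g i ≡ 0ℚ) → sum g ≡ g a
∑-support₁ {g = g} zero    g≡0 = trans (cong (_+_ (g zero)) (∑-zero (λ i → g≡0 (suc i) λ ()))) (+-identityʳ (g zero))
∑-support₁ {g = g} (suc a) g≡0 = begin
  g zero + sum (g ∘ suc)  ≡⟨ cong₂ _+_ (g≡0 zero λ ())
                                        (∑-support₁ a λ i i≢a → g≡0 (suc i) (i≢a ∘ suc-injective)) ⟩
  0ℚ + g (suc a)          ≡⟨ +-identityˡ (g (suc a)) ⟩
  g (suc a)               ∎
  where open ≡-Reasoning

∑-support₂ : ∀ {n} {g : Fin n → ℚ} {a b} → a ≢ b →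
             (∀ i → i ≢ a → i ≢ b → g i ≡ 0ℚ) → sum g ≡ g a + g b
∑-support₂ {a = zero}  {zero}  a≢b g≡0 = contradiction refl a≢b
∑-support₂ {g = g} {zero}  {suc b} a≢b g≡0 =
  cong (_+_ (g zero)) (∑-support₁ b λ i i≢b → g≡0 (suc i) (λ ()) (i≢b ∘ suc-injective))
∑-support₂ {g = g} {suc a} {zero}  a≢b g≡0 =
  trans (cong (_+_ (g zero)) (∑-support₁ a λ i i≢a → g≡0 (suc i) (i≢a ∘ suc-injective) (λ ())))
        (+-comm (g zero) (g (suc a)))
∑-support₂ {g = g} {suc a} {suc b} a≢b g≡0 = begin
  g zero + sum (g ∘ suc)       ≡⟨ cong₂ _+_ (g≡0 zero (λ ()) (λ ())) (∑-support₂ (a≢b ∘ cong suc)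
                                    λ i i≢a i≢b → g≡0 (suc i) (i≢a ∘ suc-injective) (i≢b ∘ suc-injective)) ⟩
  0ℚ + (g (suc a) + g (suc b)) ≡⟨ +-identityˡ _ ⟩
  g (suc a) + g (suc b)        ∎
  where open ≡-Reasoning

∑-δ : ∀ {n} (a : Fin n) (g : Fin n → ℚ) → ∑[ i < n ] ([ a ≟ i ] * g i) ≡ g a
∑-δ a g = trans (∑-support₁ a λ i i≢a → trans (cong (_* g i) ([]≡0 (a ≟ i) (i≢a ∘ sym))) (*-zeroˡ (g i)))
                (trans (cong (_* g a) ([]≡1 (a ≟ a) refl)) (*-identityˡ (g a)))

∑*∑ : ∀ {m n} (g : Fin m → ℚ) (h : Fin n → ℚ) → sum g * sum h ≡ ∑[ i < m ] ∑[ j < n ] (g i * h j)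
∑*∑ g h = trans (*-distribʳ-sum (sum h) g) (sum-cong-≗ λ i → *-distribˡ-sum (g i) h)

∑∑-diagonal : ∀ {n} (g : Fin n → Fin n → ℚ) →
  ∑[ i < n ] ∑[ j < n ] g i j ≡ ∑[ i < n ] g i i + ∑[ i < n ] ∑[ j < n ] ([ i ≠ j ] * g i j)
∑∑-diagonal {n} g = trans (sum-cong-≗ row) (∑-distrib-+ (λ i → g i i) (λ i → ∑[ j < n ] ([ i ≠ j ] * g i j)))
  where
  split : ∀ i j → g i j ≡ [ i ≟ j ] * g i j + [ i ≠ j ] * g i j
  split i j = begin
    g i j                               ≡⟨ *-identityˡ (g i j) ⟨
    1ℚ * g i j                          ≡⟨ cong (_* g i j) ([]+[¬]≡1 (i ≟ j)) ⟨
    ([ i ≟ j ] + [ i ≠ j ]) * g i j     ≡⟨ *-distribʳ-+ (g i j) [ i ≟ j ] [ i ≠ j ] ⟩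
    [ i ≟ j ] * g i j + [ i ≠ j ] * g i j ∎
    where open ≡-Reasoning
  row : ∀ i → ∑[ j < n ] g i j ≡ g i i + ∑[ j < n ] ([ i ≠ j ] * g i j)
  row i = trans (sum-cong-≗ (split i))
    (trans (∑-distrib-+ (λ j → [ i ≟ j ] * g i j) (λ j → [ i ≠ j ] * g i j))
           (cong (_+ ∑[ j < n ] ([ i ≠ j ] * g i j)) (∑-δ i (g i))))

∑-mono-≤ : ∀ {n} {g h : Fin n → ℚ} → (∀ i → g i ≤ h i) → sum g ≤ sum h
∑-mono-≤ {zero}  g≤h = ≤-refl
∑-mono-≤ {suc n} g≤h = +-mono-≤ (g≤h zero) (∑-mono-≤ (g≤h ∘ suc))

0≤∑ : ∀ {n} {g : Fin n → ℚ} → (∀ i → 0ℚ ≤ g i) → 0ℚ ≤ sum g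
0≤∑ {n} 0≤g = ≤-trans (≤-reflexive (sym (sum-replicate-zero n))) (∑-mono-≤ 0≤g)

module _ {A : Set} where

  sumList-cong : ∀ (l : List A) {g h : A → ℚ} → (∀ a → g a ≡ h a) → sumList l g ≡ sumList l h
  sumList-cong List.[]        g≡h = refl
  sumList-cong (a List.∷ l)   g≡h = cong₂ _+_ (g≡h a) (sumList-cong l g≡h)

  sumList-+ : ∀ (l : List A) (g h : A → ℚ) → sumList l (λ a → g a + h a) ≡ sumList l g + sumList l h
  sumList-+ List.[]        g h = sym (+-identityˡ 0ℚ)
  sumList-+ (a List.∷ l)   g h =
    trans (cong (_+_ (g a + h a)) (sumList-+ l g h)) (+-interchange (g a) (h a) (sumList l g) (sumList l h))

  sumList-*ˡ : ∀ (l : List A) c (g : A → ℚ) → sumList l (λ a → c * g a) ≡ c * sumList l g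
  sumList-*ˡ List.[]        c g = sym (*-zeroʳ c)
  sumList-*ˡ (a List.∷ l)   c g = trans (cong (_+_ (c * g a)) (sumList-*ˡ l c g)) (sym (*-distribˡ-+ c (g a) (sumList l g)))

module _ {A : Set} (D : Distribution A) where

  𝔼-cong : {Z W : A → ℚ} → (∀ a → Z a ≡ W a) → 𝔼 D Z ≡ 𝔼 D W
  𝔼-cong Z≡W = sumList-cong (support D) λ (p , a) → cong (p *_) (Z≡W a)

  𝔼-+ : ∀ (Z W : A → ℚ) → 𝔼 D (λ a → Z a + W a) ≡ 𝔼 D Z + 𝔼 D W
  𝔼-+ Z W = trans (sumList-cong (support D) λ (p , a) → *-distribˡ-+ p (Z a) (W a)) (sumList-+ (support D) _ _)

  𝔼-*ˡ : ∀ c (Z : A → ℚ) → 𝔼 D (λ a → c * Z a) ≡ c * 𝔼 D Z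
  𝔼-*ˡ c Z = trans (sumList-cong (support D) λ (p , a) → x∙yz≈y∙xz p c (Z a)) (sumList-*ˡ (support D) c _)

  𝔼-const : ∀ c → 𝔼 D (λ _ → c) ≡ c
  𝔼-const c = begin
    𝔼 D (λ _ → c)                            ≡⟨ sumList-cong (support D) (λ (p , _) → *-comm p c) ⟩
    sumList (support D) (λ q → c * proj₁ q)  ≡⟨ sumList-*ˡ (support D) c proj₁ ⟩
    c * sumList (support D) proj₁            ≡⟨ cong (c *_) (total D) ⟩
    c * 1ℚ                                   ≡⟨ *-identityʳ c ⟩
    c                                        ∎
    where open ≡-Reasoning

  𝔼-∑ : ∀ n (Z : Fin n → A → ℚ) → 𝔼 D (λ a → ∑[ i < n ] Z i a) ≡ ∑[ i < n ] 𝔼 D (Z i)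
  𝔼-∑ zero    Z = 𝔼-const 0ℚ
  𝔼-∑ (suc n) Z = trans (𝔼-+ (Z zero) _) (cong (_+_ (𝔼 D (Z zero))) (𝔼-∑ n (Z ∘ suc)))

  𝔼-∑∑-* : ∀ m n (c : Fin m → Fin n → ℚ) (Z : Fin m → Fin n → A → ℚ) →
    𝔼 D (λ a → ∑[ i < m ] ∑[ j < n ] (c i j * Z i j a)) ≡ ∑[ i < m ] ∑[ j < n ] (c i j * 𝔼 D (Z i j))
  𝔼-∑∑-* m n c Z =
    trans (𝔼-∑ m _) (sum-cong-≗ λ i → trans (𝔼-∑ n _) (sum-cong-≗ λ j → 𝔼-*ˡ (c i j) (Z i j)))

  module _ {Z W : A → ℚ} {c : ℚ} (Z≡c+W : ∀ a → Z a ≡ c + W a) (𝔼W≡0 : 𝔼 D W ≡ 0ℚ) where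

    𝔼-shift : 𝔼 D Z ≡ c
    𝔼-shift = begin
      𝔼 D Z                     ≡⟨ 𝔼-cong Z≡c+W ⟩
      𝔼 D (λ a → c + W a)       ≡⟨ 𝔼-+ (λ _ → c) W ⟩
      𝔼 D (λ _ → c) + 𝔼 D W     ≡⟨ cong₂ _+_ (𝔼-const c) 𝔼W≡0 ⟩
      c + 0ℚ                    ≡⟨ +-identityʳ c ⟩
      c                         ∎
      where open ≡-Reasoning

    Var-shift : Var D Z ≡ 𝔼 D (λ a → W a * W a)
    Var-shift = begin
      𝔼 D (λ a → Z a * Z a) - 𝔼 D Z * 𝔼 D Z
        ≡⟨ cong₂ _-_ (𝔼-cong square) (cong₂ _*_ 𝔼-shift 𝔼-shift) ⟩
      𝔼 D (λ a → c * c + ((c + c) * W a + W² a)) - c * c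
        ≡⟨ cong (_- c * c) (trans (𝔼-+ (λ _ → c * c) _) (cong₂ _+_ (𝔼-const (c * c)) (𝔼-+ _ W²))) ⟩
      c * c + (𝔼 D (λ a → (c + c) * W a) + 𝔼 D W²) - c * c
        ≡⟨ cong (λ e → c * c + (e + 𝔼 D W²) - c * c) (trans (𝔼-*ˡ (c + c) W) (cong ((c + c) *_) 𝔼W≡0)) ⟩
      c * c + ((c + c) * 0ℚ + 𝔼 D W²) - c * c
        ≡⟨ solve 2 (λ c e → c :* c :+ ((c :+ c) :* con 0ℚ :+ e) :- c :* c := e) refl c (𝔼 D W²) ⟩
      𝔼 D W²                    ∎
      where
      open ≡-Reasoning
      W² : A → ℚ
      W² a = W a * W a
      square : ∀ a → Z a * Z a ≡ c * c + ((c + c) * W a + W² a)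
      square a = trans (cong₂ _*_ (Z≡c+W a) (Z≡c+W a))
        (solve 2 (λ c w → (c :+ w) :* (c :+ w) := c :* c :+ ((c :+ c) :* w :+ w :* w)) refl c (W a))

∷-injective : ∀ {A : Set} {n} {a : A} {f : Fin n → A} →
  (∀ j → a ≢ f j) → Injective _≡_ _≡_ f → Injective _≡_ _≡_ (a ∷ f)
∷-injective a∉f f-inj {zero}  {zero}  _   = refl
∷-injective a∉f f-inj {zero}  {suc j} a≡fj = contradiction a≡fj (a∉f j)
∷-injective a∉f f-inj {suc i} {zero}  fi≡a = contradiction (sym fi≡a) (a∉f i)
∷-injective a∉f f-inj {suc i} {suc j} fi≡fj = cong suc (f-inj fi≡fj)

[]-injective : ∀ {A : Set} → Injective _≡_ _≡_ ([] {A = A})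
[]-injective {x = ()}

bucket : ∀ {u r} → Outcome u r → Fin u → Fin r
bucket ω x = proj₁ ω x

sign : ∀ {u r} → Outcome u r → Fin u → ℚ
sign ω x = signℚ (proj₂ ω x)

module _ {u r : ℕ} (D : Distribution (Outcome u r)) where

  SignCancellation-pred : ∀ {k} → SignCancellation (suc k) D → SignCancellation k D
  SignCancellation-pred sc m m<k = sc m (ℕ.m≤n⇒m≤1+n m<k)

  -- H takes individual bucket and sign values rather than vectors: the A handed to
  -- SignCancellation then matches definitionally, without function extensionality.
  lonely-sign-cancels₁ : SignCancellation 2 D → ∀ {e a} → e ≢ a → (H : Fin r → Fin r → ℚ → ℚ) →
    𝔼 D (λ ω → sign ω e * H (bucket ω e) (bucket ω a) (sign ω a)) ≡ 0ℚ
  lonely-sign-cancels₁ sc {e} {a} e≢a H =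
    sc 1 ℕ.≤-refl (e ∷ a ∷ [])
      (∷-injective (λ { zero → e≢a }) (∷-injective (λ ()) []-injective))
      (λ is ss → H (is zero) (is (suc zero)) (signℚ (ss zero)))

  -- The other keys need not be distinct: coinciding ones are merged before applying
  -- SignCancellation, which requires distinct keys.
  lonely-sign-cancels₂ : SignCancellation 3 D → ∀ {e a b} → e ≢ a → e ≢ b →
    (H : Fin r → Fin r → Fin r → ℚ → ℚ → ℚ) →
    𝔼 D (λ ω → sign ω e * H (bucket ω e) (bucket ω a) (bucket ω b) (sign ω a) (sign ω b)) ≡ 0ℚ
  lonely-sign-cancels₂ sc {e} {a} {b} e≢a e≢b H with a ≟ b
  ... | yes refl = lonely-sign-cancels₁ (SignCancellation-pred sc) e≢a
                     (λ ie ia σa → H ie ia ia σa σa)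
  ... | no a≢b = sc 2 ℕ.≤-refl (e ∷ a ∷ b ∷ [])
                   (∷-injective (λ { zero → e≢a ; (suc zero) → e≢b })
                     (∷-injective (λ { zero → a≢b }) (∷-injective (λ ()) []-injective)))
                   (λ is ss → H (is zero) (is (suc zero)) (is (suc (suc zero)))
                                (signℚ (ss zero)) (signℚ (ss (suc zero))))

  lonely-sign-cancels₃ : SignCancellation 4 D → ∀ {e a b c} → e ≢ a → e ≢ b → e ≢ c →
    (H : Fin r → Fin r → Fin r → Fin r → ℚ → ℚ → ℚ → ℚ) →
    𝔼 D (λ ω → sign ω e * H (bucket ω e) (bucket ω a) (bucket ω b) (bucket ω c)
                               (sign ω a) (sign ω b) (sign ω c)) ≡ 0ℚ
  lonely-sign-cancels₃ sc {e} {a} {b} {c} e≢a e≢b e≢c H with a ≟ b | a ≟ c | b ≟ c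
  ... | yes refl | _        | _        = lonely-sign-cancels₂ (SignCancellation-pred sc) e≢a e≢c
                                            (λ ie ia ic σa σc → H ie ia ia ic σa σa σc)
  ... | no _     | yes refl | _        = lonely-sign-cancels₂ (SignCancellation-pred sc) e≢a e≢b
                                            (λ ie ia ib σa σb → H ie ia ib ia σa σb σa)
  ... | no _     | no _     | yes refl = lonely-sign-cancels₂ (SignCancellation-pred sc) e≢a e≢b
                                            (λ ie ia ib σa σb → H ie ia ib ib σa σb σb)
  ... | no a≢b   | no a≢c   | no b≢c   = sc 3 ℕ.≤-refl (e ∷ a ∷ b ∷ c ∷ [])
        (∷-injective (λ { zero → e≢a ; (suc zero) → e≢b ; (suc (suc zero)) → e≢c })
          (∷-injective (λ { zero → a≢b ; (suc zero) → a≢c })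
            (∷-injective (λ { zero → b≢c }) (∷-injective (λ ()) []-injective))))
        (λ is ss → H (is zero) (is (suc zero)) (is (suc (suc zero))) (is (suc (suc (suc zero))))
                     (signℚ (ss zero)) (signℚ (ss (suc zero))) (signℚ (ss (suc (suc zero)))))

module _ {u : ℕ} (f : Fin u → ℤ) where

  fℚ : Fin u → ℚ
  fℚ x = ℤ→ℚ (f x)

  f²f² : Fin u → Fin u → ℚ
  f²f² x y = (fℚ x * fℚ x) * (fℚ y * fℚ y)

  F₂ : ℚ
  F₂ = ∑[ x < u ] (fℚ x * fℚ x)

  F₄ : ℚ
  F₄ = ∑[ x < u ] f²f² x x

  F-2≡F₂ : F 2 f ≡ F₂
  F-2≡F₂ = trans (sumFin≡sum u _) (sum-cong-≗ (ℤ→ℚ-^2 ∘ f))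

  F-4≡F₄ : F 4 f ≡ F₄
  F-4≡F₄ = trans (sumFin≡sum u _) (sum-cong-≗ (ℤ→ℚ-^4 ∘ f))

  0≤f²f² : ∀ x y → 0ℚ ≤ f²f² x y
  0≤f²f² x y = nonNegative⁻¹ (f²f² x y)
    {{nonNeg*nonNeg⇒nonNeg (fℚ x * fℚ x) {{nonNegative (0≤p*p (fℚ x))}}
                           (fℚ y * fℚ y) {{nonNegative (0≤p*p (fℚ y))}}}}

  0≤F₄ : 0ℚ ≤ F₄
  0≤F₄ = 0≤∑ λ x → 0≤f²f² x x

  ∑∑-off-diagonal-f²f² : ∑[ x < u ] ∑[ y < u ] ([ x ≠ y ] * f²f² x y) ≡ F₂ * F₂ - F₄
  ∑∑-off-diagonal-f²f² = begin
    O                                       ≡⟨ solve 2 (λ d o → o := d :+ o :- d) refl F₄ O ⟩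
    F₄ + O - F₄                             ≡⟨ cong (_- F₄) (∑∑-diagonal f²f²) ⟨
    ∑[ x < u ] ∑[ y < u ] f²f² x y - F₄     ≡⟨ cong (_- F₄) (∑*∑ (λ x → fℚ x * fℚ x) (λ y → fℚ y * fℚ y)) ⟨
    F₂ * F₂ - F₄                            ∎
    where
    open ≡-Reasoning
    O : ℚ
    O = ∑[ x < u ] ∑[ y < u ] ([ x ≠ y ] * f²f² x y)

  module _ {r : ℕ} where

    weight : Outcome u r → Fin u → ℚ
    weight ω x = sign ω x * fℚ x

    collision : Outcome u r → Fin u → Fin u → ℚ
    collision ω x y = [ bucket ω x ≟ bucket ω y ]

    pairTerm : Fin u → Fin u → Outcome u r → ℚ
    pairTerm x y ω = weight ω x * weight ω y * collision ω x y

    X≡∑∑pairTerm : ∀ ω → X f ω ≡ ∑[ x < u ] ∑[ y < u ] pairTerm x y ω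
    X≡∑∑pairTerm ω = begin
      X f ω
        ≡⟨ trans (sumFin≡sum r (λ t → sumFin u (c t) * sumFin u (c t)))
             (sum-cong-≗ λ t → cong₂ _*_ (sumFin≡sum u (c t)) (sumFin≡sum u (c t))) ⟩
      ∑[ t < r ] (sum (c t) * sum (c t))
        ≡⟨ sum-cong-≗ (λ t → ∑*∑ (c t) (c t)) ⟩
      ∑[ t < r ] ∑[ x < u ] ∑[ y < u ] (c t x * c t y)
        ≡⟨ ∑-comm (λ t x → ∑[ y < u ] (c t x * c t y)) ⟩
      ∑[ x < u ] ∑[ t < r ] ∑[ y < u ] (c t x * c t y)
        ≡⟨ sum-cong-≗ (λ x → ∑-comm (λ t y → c t x * c t y)) ⟩
      ∑[ x < u ] ∑[ y < u ] ∑[ t < r ] (c t x * c t y)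
        ≡⟨ sum-cong-≗ (λ x → sum-cong-≗ (∑-bucket x)) ⟩
      ∑[ x < u ] ∑[ y < u ] pairTerm x y ω ∎
      where
      open ≡-Reasoning
      c : Fin r → Fin u → ℚ
      c t x = weight ω x * [ bucket ω x ≟ t ]
      ∑-bucket : ∀ x y → ∑[ t < r ] (c t x * c t y) ≡ pairTerm x y ω
      ∑-bucket x y = begin
        ∑[ t < r ] (c t x * c t y)
          ≡⟨ sum-cong-≗ (λ t → solve 4 (λ a b p q → (a :* p) :* (b :* q) := p :* (a :* b :* q)) refl
                                   (weight ω x) (weight ω y) [ bucket ω x ≟ t ] [ bucket ω y ≟ t ]) ⟩
        ∑[ t < r ] ([ bucket ω x ≟ t ] * (weight ω x * weight ω y * [ bucket ω y ≟ t ]))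
          ≡⟨ ∑-δ (bucket ω x) (λ t → weight ω x * weight ω y * [ bucket ω y ≟ t ]) ⟩
        weight ω x * weight ω y * [ bucket ω y ≟ bucket ω x ]
          ≡⟨ cong (weight ω x * weight ω y *_) ([≟]-sym (bucket ω y) (bucket ω x)) ⟩
        pairTerm x y ω ∎

    pairTerm-diagonal : ∀ x ω → pairTerm x x ω ≡ fℚ x * fℚ x
    pairTerm-diagonal x ω = begin
      weight ω x * weight ω x * collision ω x x
        ≡⟨ cong (weight ω x * weight ω x *_) ([]≡1 (bucket ω x ≟ bucket ω x) refl) ⟩
      weight ω x * weight ω x * 1ℚ
        ≡⟨ solve 2 (λ s a → s :* a :* (s :* a) :* con 1ℚ := s :* s :* (a :* a)) refl (sign ω x) (fℚ x) ⟩
      sign ω x * sign ω x * (fℚ x * fℚ x)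
        ≡⟨ cong (_* (fℚ x * fℚ x)) (signℚ²≡1 (proj₂ ω x)) ⟩
      1ℚ * (fℚ x * fℚ x)
        ≡⟨ *-identityˡ (fℚ x * fℚ x) ⟩
      fℚ x * fℚ x ∎
      where open ≡-Reasoning

    pairTerm-sym : ∀ x y ω → pairTerm x y ω ≡ pairTerm y x ω
    pairTerm-sym x y ω = cong₂ _*_ (*-comm (weight ω x) (weight ω y)) ([≟]-sym (bucket ω x) (bucket ω y))

    pairTerm² : ∀ x y ω → pairTerm x y ω * pairTerm x y ω ≡ f²f² x y * collision ω x y
    pairTerm² x y ω = begin
      pairTerm x y ω * pairTerm x y ω
        ≡⟨ solve 5 (λ s t a b c → s :* a :* (t :* b) :* c :* (s :* a :* (t :* b) :* c)
                                   := s :* s :* (t :* t) :* ((a :* a) :* (b :* b)) :* (c :* c))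
                 refl (sign ω x) (sign ω y) (fℚ x) (fℚ y) (collision ω x y) ⟩
      sign ω x * sign ω x * (sign ω y * sign ω y) * f²f² x y * (collision ω x y * collision ω x y)
        ≡⟨ cong₂ (λ p q → p * f²f² x y * q) (cong₂ _*_ (signℚ²≡1 (proj₂ ω x)) (signℚ²≡1 (proj₂ ω y)))
                 ([]-idem (bucket ω x ≟ bucket ω y)) ⟩
      1ℚ * 1ℚ * f²f² x y * collision ω x y
        ≡⟨ cong (_* collision ω x y) (*-identityˡ (f²f² x y)) ⟩
      f²f² x y * collision ω x y ∎
      where open ≡-Reasoning

    crossTerms : Outcome u r → ℚ
    crossTerms ω = ∑[ x < u ] ∑[ y < u ] ([ x ≠ y ] * pairTerm x y ω)

    X≡F₂+crossTerms : ∀ ω → X f ω ≡ F₂ + crossTerms ω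
    X≡F₂+crossTerms ω = trans (X≡∑∑pairTerm ω)
      (trans (∑∑-diagonal (λ x y → pairTerm x y ω)) (cong (_+ crossTerms ω) (sum-cong-≗ λ x → pairTerm-diagonal x ω)))

    module _ (D : Distribution (Outcome u r)) (sc : SignCancellation 4 D) where

      𝔼-pairTerm : ∀ {x y} → x ≢ y → 𝔼 D (pairTerm x y) ≡ 0ℚ
      𝔼-pairTerm {x} {y} x≢y = trans (𝔼-cong D factor)
        (lonely-sign-cancels₁ D (SignCancellation-pred D (SignCancellation-pred D sc)) x≢y
          (λ ix iy sy → fℚ x * (sy * fℚ y) * [ ix ≟ iy ]))
        where
        factor : ∀ ω → pairTerm x y ω ≡ sign ω x * (fℚ x * weight ω y * collision ω x y)
        factor ω = solve 4 (λ s a w c → s :* a :* w :* c := s :* (a :* w :* c)) refl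
                           (sign ω x) (fℚ x) (weight ω y) (collision ω x y)

      𝔼-crossTerms : 𝔼 D crossTerms ≡ 0ℚ
      𝔼-crossTerms = trans (𝔼-∑∑-* D u u [_≠_] pairTerm)
        (∑-zero λ x → ∑-zero λ y → [≠]*-vanish x y 𝔼-pairTerm)

      𝔼X≡F₂ : 𝔼 D (X f) ≡ F₂
      𝔼X≡F₂ = 𝔼-shift D X≡F₂+crossTerms 𝔼-crossTerms

      VarX≡𝔼crossTerms² : Var D (X f) ≡ 𝔼 D (λ ω → crossTerms ω * crossTerms ω)
      VarX≡𝔼crossTerms² = Var-shift D {X f} {crossTerms} {F₂} X≡F₂+crossTerms 𝔼-crossTerms

      𝔼-pairTerm*pairTerm-lonelyˡ : ∀ {x y z w} → z ≢ x → z ≢ y → z ≢ w →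
        𝔼 D (λ ω → pairTerm x y ω * pairTerm z w ω) ≡ 0ℚ
      𝔼-pairTerm*pairTerm-lonelyˡ {x} {y} {z} {w} z≢x z≢y z≢w = trans (𝔼-cong D factor)
        (lonely-sign-cancels₃ D sc z≢w z≢x z≢y
          (λ iz iw ix iy sw sx sy → sx * fℚ x * (sy * fℚ y) * [ ix ≟ iy ] * (fℚ z * (sw * fℚ w) * [ iz ≟ iw ])))
        where
        factor : ∀ ω → pairTerm x y ω * pairTerm z w ω
                       ≡ sign ω z * (pairTerm x y ω * (fℚ z * weight ω w * collision ω z w))
        factor ω = solve 5 (λ p s a v c → p :* (s :* a :* v :* c) := s :* (p :* (a :* v :* c))) refl
                           (pairTerm x y ω) (sign ω z) (fℚ z) (weight ω w) (collision ω z w)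

      𝔼-pairTerm*pairTerm-lonelyʳ : ∀ {x y z w} → w ≢ x → w ≢ y → w ≢ z →
        𝔼 D (λ ω → pairTerm x y ω * pairTerm z w ω) ≡ 0ℚ
      𝔼-pairTerm*pairTerm-lonelyʳ {x} {y} {z} {w} w≢x w≢y w≢z =
        trans (𝔼-cong D λ ω → cong (pairTerm x y ω *_) (pairTerm-sym z w ω))
              (𝔼-pairTerm*pairTerm-lonelyˡ w≢x w≢y w≢z)

      collisionMass : Fin u → Fin u → ℚ
      collisionMass x y = f²f² x y * 𝔼 D (λ ω → collision ω x y)

      𝔼-pairTerm² : ∀ x y → 𝔼 D (λ ω → pairTerm x y ω * pairTerm x y ω) ≡ collisionMass x y
      𝔼-pairTerm² x y = trans (𝔼-cong D (pairTerm² x y)) (𝔼-*ˡ D (f²f² x y) (λ ω → collision ω x y))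

      -- Only (z , w) = (x , y) and (y , x) survive: in every other term some key occurs exactly once.
      𝔼-pairTerm*crossTerms : ∀ {x y} → x ≢ y →
        𝔼 D (λ ω → pairTerm x y ω * crossTerms ω) ≡ (+ 2 / 1) * collisionMass x y
      𝔼-pairTerm*crossTerms {x} {y} x≢y = begin
        𝔼 D (λ ω → pairTerm x y ω * crossTerms ω)
          ≡⟨ 𝔼-cong D expand ⟩
        𝔼 D (λ ω → ∑[ z < u ] ∑[ w < u ] ([ z ≠ w ] * (pairTerm x y ω * pairTerm z w ω)))
          ≡⟨ 𝔼-∑∑-* D u u [_≠_] (λ z w ω → pairTerm x y ω * pairTerm z w ω) ⟩
        ∑[ z < u ] ∑[ w < u ] G z w
          ≡⟨ ∑-support₂ x≢y other-rows ⟩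
        ∑[ w < u ] G x w + ∑[ w < u ] G y w
          ≡⟨ cong₂ _+_ (∑-support₁ y row-x) (∑-support₁ x row-y) ⟩
        G x y + G y x
          ≡⟨ cong₂ _+_ ([≠]*-distinct x≢y) ([≠]*-distinct (x≢y ∘ sym)) ⟩
        𝔼 D (λ ω → pairTerm x y ω * pairTerm x y ω) + 𝔼 D (λ ω → pairTerm x y ω * pairTerm y x ω)
          ≡⟨ cong₂ _+_ (𝔼-pairTerm² x y)
                       (trans (𝔼-cong D λ ω → cong (pairTerm x y ω *_) (pairTerm-sym y x ω)) (𝔼-pairTerm² x y)) ⟩
        collisionMass x y + collisionMass x y
          ≡⟨ solve 1 (λ m → m :+ m := con (+ 2 / 1) :* m) refl (collisionMass x y) ⟩
        (+ 2 / 1) * collisionMass x y ∎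
        where
        open ≡-Reasoning
        G : Fin u → Fin u → ℚ
        G z w = [ z ≠ w ] * 𝔼 D (λ ω → pairTerm x y ω * pairTerm z w ω)
        other-rows : ∀ z → z ≢ x → z ≢ y → ∑[ w < u ] G z w ≡ 0ℚ
        other-rows z z≢x z≢y = ∑-zero λ w → [≠]*-vanish z w (𝔼-pairTerm*pairTerm-lonelyˡ z≢x z≢y)
        row-x : ∀ w → w ≢ y → G x w ≡ 0ℚ
        row-x w w≢y = [≠]*-vanish x w λ x≢w → 𝔼-pairTerm*pairTerm-lonelyʳ (x≢w ∘ sym) w≢y (x≢w ∘ sym)
        row-y : ∀ w → w ≢ x → G y w ≡ 0ℚ
        row-y w w≢x = [≠]*-vanish y w λ y≢w → 𝔼-pairTerm*pairTerm-lonelyʳ w≢x (y≢w ∘ sym) (y≢w ∘ sym)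
        expand : ∀ ω → pairTerm x y ω * crossTerms ω
                       ≡ ∑[ z < u ] ∑[ w < u ] ([ z ≠ w ] * (pairTerm x y ω * pairTerm z w ω))
        expand ω =
          trans (*-distribˡ-sum (pairTerm x y ω) (λ z → ∑[ w < u ] ([ z ≠ w ] * pairTerm z w ω))) (sum-cong-≗ λ z →
          trans (*-distribˡ-sum (pairTerm x y ω) (λ w → [ z ≠ w ] * pairTerm z w ω)) (sum-cong-≗ λ w →
          x∙yz≈y∙xz (pairTerm x y ω) [ z ≠ w ] (pairTerm z w ω)))

      𝔼-crossTerms² : 𝔼 D (λ ω → crossTerms ω * crossTerms ω)
                      ≡ ∑[ x < u ] ∑[ y < u ] ([ x ≠ y ] * ((+ 2 / 1) * collisionMass x y))
      𝔼-crossTerms² = begin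
        𝔼 D (λ ω → crossTerms ω * crossTerms ω)
          ≡⟨ 𝔼-cong D expand ⟩
        𝔼 D (λ ω → ∑[ x < u ] ∑[ y < u ] ([ x ≠ y ] * (pairTerm x y ω * crossTerms ω)))
          ≡⟨ 𝔼-∑∑-* D u u [_≠_] (λ x y ω → pairTerm x y ω * crossTerms ω) ⟩
        ∑[ x < u ] ∑[ y < u ] ([ x ≠ y ] * 𝔼 D (λ ω → pairTerm x y ω * crossTerms ω))
          ≡⟨ sum-cong-≗ (λ x → sum-cong-≗ λ y → [≠]*-cong x y 𝔼-pairTerm*crossTerms) ⟩
        ∑[ x < u ] ∑[ y < u ] ([ x ≠ y ] * ((+ 2 / 1) * collisionMass x y)) ∎
        where
        open ≡-Reasoning
        expand : ∀ ω → crossTerms ω * crossTerms ω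
                       ≡ ∑[ x < u ] ∑[ y < u ] ([ x ≠ y ] * (pairTerm x y ω * crossTerms ω))
        expand ω =
          trans (*-distribʳ-sum (crossTerms ω) (λ x → ∑[ y < u ] ([ x ≠ y ] * pairTerm x y ω))) (sum-cong-≗ λ x →
          trans (*-distribʳ-sum (crossTerms ω) (λ y → [ x ≠ y ] * pairTerm x y ω)) (sum-cong-≗ λ y →
          *-assoc [ x ≠ y ] (pairTerm x y ω) (crossTerms ω)))

      module _ .{{_ : NonZero r}} (ε : ℚ) (lc : LowCollision ε D) where

        collisionBound : ℚ
        collisionBound = (1ℚ + ε) * (+ 1 / r)

        off-diagonal-bound : ∀ x y → [ x ≠ y ] * ((+ 2 / 1) * collisionMass x y)
                                      ≤ ((+ 2 / 1) * collisionBound) * ([ x ≠ y ] * f²f² x y)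
        off-diagonal-bound x y with x ≟ y
        ... | yes _ = ≤-reflexive (trans (*-zeroˡ ((+ 2 / 1) * collisionMass x y))
                        (sym (trans (cong (_*_ ((+ 2 / 1) * collisionBound)) (*-zeroˡ (f²f² x y)))
                                    (*-zeroʳ ((+ 2 / 1) * collisionBound)))))
        ... | no x≢y = begin
          1ℚ * ((+ 2 / 1) * (f²f² x y * 𝔼 D (λ ω → collision ω x y)))
            ≡⟨ *-identityˡ _ ⟩
          (+ 2 / 1) * (f²f² x y * 𝔼 D (λ ω → collision ω x y))
            ≤⟨ *-monoˡ-≤-nonNeg (+ 2 / 1) (*-monoˡ-≤-nonNeg (f²f² x y) {{nonNegative (0≤f²f² x y)}} (lc x y x≢y)) ⟩
          (+ 2 / 1) * (f²f² x y * collisionBound)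
            ≡⟨ solve 3 (λ t a b → t :* (a :* b) := t :* b :* (con 1ℚ :* a)) refl (+ 2 / 1) (f²f² x y) collisionBound ⟩
          ((+ 2 / 1) * collisionBound) * (1ℚ * f²f² x y) ∎
          where open ≤-Reasoning

        VarX-bound : Var D (X f) ≤ (+ 2 / 1) * (1ℚ + ε) * (F₂ * F₂ - F₄) * (+ 1 / r)
        VarX-bound = begin
          Var D (X f)
            ≡⟨ trans VarX≡𝔼crossTerms² 𝔼-crossTerms² ⟩
          ∑[ x < u ] ∑[ y < u ] ([ x ≠ y ] * ((+ 2 / 1) * collisionMass x y))
            ≤⟨ ∑-mono-≤ (λ x → ∑-mono-≤ (off-diagonal-bound x)) ⟩
          ∑[ x < u ] ∑[ y < u ] (K * ([ x ≠ y ] * f²f² x y))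
            ≡⟨ trans (sum-cong-≗ λ x → sym (*-distribˡ-sum K (λ y → [ x ≠ y ] * f²f² x y)))
                     (sym (*-distribˡ-sum K (λ x → ∑[ y < u ] ([ x ≠ y ] * f²f² x y)))) ⟩
          K * ∑[ x < u ] ∑[ y < u ] ([ x ≠ y ] * f²f² x y)
            ≡⟨ cong (K *_) ∑∑-off-diagonal-f²f² ⟩
          K * (F₂ * F₂ - F₄)
            ≡⟨ solve 3 (λ e v m → con (+ 2 / 1) :* ((con 1ℚ :+ e) :* v) :* m := con (+ 2 / 1) :* (con 1ℚ :+ e) :* m :* v)
                     refl ε (+ 1 / r) (F₂ * F₂ - F₄) ⟩
          (+ 2 / 1) * (1ℚ + ε) * (F₂ * F₂ - F₄) * (+ 1 / r) ∎
          where
          open ≤-Reasoning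
          K : ℚ
          K = (+ 2 / 1) * collisionBound

lemma4 : (u r : ℕ) → .{{_ : NonZero r}} → (D : Distribution (Outcome u r)) →
         SignCancellation 4 D → (ε : ℚ) → 0ℚ ≤ ε → LowCollision ε D →
         (f : Fin u → ℤ) →
         (𝔼 D (X f) ≡ F 2 f)
         × (Var D (X f) ≤ (+ 2 / 1) * (1ℚ + ε) * (F 2 f * F 2 f - F 4 f) * (+ 1 / r))
         × ((+ 2 / 1) * (1ℚ + ε) * (F 2 f * F 2 f - F 4 f) * (+ 1 / r)
              ≤ (+ 2 / 1) * (1ℚ + ε) * (F 2 f * F 2 f) * (+ 1 / r))
lemma4 u r D sc ε 0≤ε lc f rewrite F-2≡F₂ f | F-4≡F₄ f =
    𝔼X≡F₂ f D sc
  , VarX-bound f D sc ε lc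
  , *-monoʳ-≤-nonNeg (+ 1 / r) {{normalize-nonNeg 1 r}}
      (*-monoˡ-≤-nonNeg ((+ 2 / 1) * (1ℚ + ε)) {{0≤2[1+ε]}} (p-q≤p (F₂ f * F₂ f) (0≤F₄ f)))
  where
  0≤2[1+ε] : NonNegative ((+ 2 / 1) * (1ℚ + ε))
  0≤2[1+ε] = nonNeg*nonNeg⇒nonNeg (+ 2 / 1) (1ℚ + ε) {{nonNegative (+-mono-≤ (nonNegative⁻¹ 1ℚ) 0≤ε)}}
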